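{- Let $\alpha,\beta\in S_n$. If some cycle of $\beta$ contains exactly one bad commuting point of $\alpha$ and $\beta$, then some cycle of $\beta$ contains at least two bad commuting points of $\alpha$ and $\beta$.
   Context: $S_n$ is the symmetric group on $[n]$, products composed right to left; cycles of $\beta$ are those of its disjoint cycle decomposition, including fixed points as $1$-cycles. A point $a\in[n]$ is a bad commuting point of $\alpha$ and $\beta$ if $\alpha\beta(a)\ne\beta\alpha(a)$. -}

module Defs where

open import Data.Nat using (ℕ; zero; suc)
open import Data.Fin using (Fin)
open import Data.Fin.Permutation using (Permutation′; _⟨$⟩ʳ_)
open import Data.Product using (∃-syntax; _×_)
open import Relation.Binary.PropositionalEquality using (_≡_)
open import Relation.Nullary using (¬_)

-- The symmetric group S_n is Permutation′ n (bijections of Fin n, i.e. [n]).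

iter : ∀ {n} → Permutation′ n → ℕ → Fin n → Fin n
iter β zero    a = a
iter β (suc k) a = β ⟨$⟩ʳ (iter β k a)

-- a lies in the cycle of β through c (cycles include fixed points as 1-cycles)
InCycle : ∀ {n} → Permutation′ n → Fin n → Fin n → Set
InCycle β c a = ∃[ k ] iter β k c ≡ a

Bad : ∀ {n} → Permutation′ n → Permutation′ n → Fin n → Set
Bad α β a = ¬ (α ⟨$⟩ʳ (β ⟨$⟩ʳ a) ≡ β ⟨$⟩ʳ (α ⟨$⟩ʳ a))

CycleHasExactlyOneBad : ∀ {n} → Permutation′ n → Permutation′ n → Fin n → Set
CycleHasExactlyOneBad α β c =
  ∃[ a ] (InCycle β c a × Bad α β a ×
          (∀ b → InCycle β c b → Bad α β b → b ≡ a))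

CycleHasTwoBad : ∀ {n} → Permutation′ n → Permutation′ n → Fin n → Set
CycleHasTwoBad α β c =
  ∃[ a ] ∃[ b ] (¬ (a ≡ b) × InCycle β c a × InCycle β c b × Bad α β a × Bad α β b)

module Submission where

-- Suppose every cycle of β had at most one bad point, and let `period β x` be the length of
-- the β-cycle of x.  If that cycle has no bad point, α commutes with every power of β on it, so
-- each return time of α x is one of x.  If it contains the bad point a, of period p, then α
-- commutes with β along the arc β a, …, a, so the cycle of α (β a), which contains α x, has
-- length at least p; and not exactly p, for then β (α a) = α (β a).  Hence `period β` never
-- decreases along the α-orbit of a bad point a and strictly increases at its first step, yet
-- the orbit returns to a.

open import Defs
open import Data.Nat using (ℕ; zero; suc; pred; _+_; _*_; _∸_; _≤_; _<_; s≤s; NonZero; _%_; _/_)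
open import Data.Nat.Properties
open import Data.Nat.DivMod using (m≡m%n+[m/n]*n; m%n<n)
open import Data.Nat.Induction using (<-rec)
open import Data.Fin using (Fin; toℕ)
open import Data.Fin.Properties using (pigeonhole; any?) renaming (_≟_ to _≟ᶠ_)
open import Data.Fin.Permutation using (Permutation′; _⟨$⟩ʳ_)
open import Data.Product using (∃; ∃-syntax; _×_; _,_; proj₁; proj₂)
open import Data.Empty using (⊥-elim)
open import Function using (_∘_)
open import Function.Bundles using (Injection)
open import Function.Properties.Inverse using (↔⇒↣)
open import Level using (Level)
open import Relation.Nullary using (¬_; Dec; yes; no)
open import Relation.Nullary.Decidable using (_×-dec_; ¬?; decidable-stable)
open import Relation.Unary using (Pred; Decidable)
open import Relation.Binary.PropositionalEquality

private
  variable
    ℓ : Level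
    n : ℕ

Least : Pred ℕ ℓ → ℕ → Set ℓ
Least P m = P m × (∀ {j} → P j → m ≤ j)

least-witness : {P : Pred ℕ ℓ} → Decidable P → ∃ P → ∃ (Least P)
least-witness {P = P} P? (k , Pk) = <-rec (λ k → P k → ∃ (Least P)) search k Pk
  where
  search : ∀ k → (∀ {j} → j < k → P j → ∃ (Least P)) → P k → ∃ (Least P)
  search k rec Pk with anyUpTo? P? k
  ... | yes (j , j<k , Pj) = rec j<k Pj
  ... | no none            = k , Pk , λ Pj → ≮⇒≥ λ j<k → none (_ , j<k , Pj)

module _ (π : Permutation′ n) where

  ⟨$⟩ʳ-injective : ∀ {a b} → π ⟨$⟩ʳ a ≡ π ⟨$⟩ʳ b → a ≡ b
  ⟨$⟩ʳ-injective = Injection.injective (↔⇒↣ π)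

  iter-+ : ∀ i j x → iter π (i + j) x ≡ iter π i (iter π j x)
  iter-+ zero    j x = refl
  iter-+ (suc i) j x = cong (π ⟨$⟩ʳ_) (iter-+ i j x)

  iter-suc : ∀ k x → iter π (suc k) x ≡ iter π k (π ⟨$⟩ʳ x)
  iter-suc k x = trans (cong (λ m → iter π m x) (+-comm 1 k)) (iter-+ k 1 x)

  iter-comm : ∀ i j x → iter π i (iter π j x) ≡ iter π j (iter π i x)
  iter-comm i j x = begin
    iter π i (iter π j x) ≡⟨ iter-+ i j x ⟨
    iter π (i + j) x      ≡⟨ cong (λ m → iter π m x) (+-comm i j) ⟩
    iter π (j + i) x      ≡⟨ iter-+ j i x ⟩
    iter π j (iter π i x) ∎
    where open ≡-Reasoning

  iter-injective : ∀ k {a b} → iter π k a ≡ iter π k b → a ≡ b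
  iter-injective zero    e = e
  iter-injective (suc k) e = iter-injective k (⟨$⟩ʳ-injective e)

  iter-*-return : ∀ {p x} → iter π p x ≡ x → ∀ m → iter π (m * p) x ≡ x
  iter-*-return         e zero    = refl
  iter-*-return {p} {x} e (suc m) =
    trans (iter-+ p (m * p) x) (trans (cong (iter π p) (iter-*-return e m)) e)

  iter-%-return : ∀ {p x} .{{_ : NonZero p}} → iter π p x ≡ x →
                  ∀ k → iter π k x ≡ iter π (k % p) x
  iter-%-return {p} {x} e k = begin
    iter π k x                            ≡⟨ cong (λ m → iter π m x) (m≡m%n+[m/n]*n k p) ⟩
    iter π (k % p + k / p * p) x          ≡⟨ iter-+ (k % p) (k / p * p) x ⟩
    iter π (k % p) (iter π (k / p * p) x) ≡⟨ cong (iter π (k % p)) (iter-*-return e (k / p)) ⟩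
    iter π (k % p) x                      ∎
    where open ≡-Reasoning

  iter-returns : ∀ x → ∃ λ k → iter π (suc k) x ≡ x
  iter-returns x with pigeonhole (n<1+n n) (λ (i : Fin (suc n)) → iter π (toℕ i) x)
  ... | i , j , i<j , e with m≤n⇒∃[o]m+o≡n i<j
  ... | d , i+1+d≡j = d , iter-injective (toℕ i) (begin
    iter π (toℕ i) (iter π (suc d) x) ≡⟨ iter-+ (toℕ i) (suc d) x ⟨
    iter π (toℕ i + suc d) x          ≡⟨ cong (λ m → iter π m x) (trans (+-suc (toℕ i) d) i+1+d≡j) ⟩
    iter π (toℕ j) x                  ≡⟨ e ⟨
    iter π (toℕ i) x                  ∎)
    where open ≡-Reasoning

private
  first-return : (π : Permutation′ n) → ∀ x → ∃ (Least λ k → iter π (suc k) x ≡ x)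
  first-return π x = least-witness (λ k → iter π (suc k) x ≟ᶠ x) (iter-returns π x)

-- Opaque: with `period` transparent, checking the lemmas below normalises the pigeonhole
-- search inside it and runs out of memory.
opaque
  period : Permutation′ n → Fin n → ℕ
  period π x = suc (proj₁ (first-return π x))

  instance
    period-nonZero : ∀ {π : Permutation′ n} {x} → NonZero (period π x)
    period-nonZero = _

  iter-period : ∀ (π : Permutation′ n) x → iter π (period π x) x ≡ x
  iter-period π x = proj₁ (proj₂ (first-return π x))

  period-minimal : ∀ (π : Permutation′ n) {x} k .{{_ : NonZero k}} →
                   iter π k x ≡ x → period π x ≤ k
  period-minimal π {x} (suc k) e = s≤s (proj₂ (proj₂ (first-return π x)) e)

module _ (π : Permutation′ n) where

  iter-pred-period : ∀ x → iter π (pred (period π x)) (π ⟨$⟩ʳ x) ≡ x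
  iter-pred-period x = begin
    iter π (pred (period π x)) (π ⟨$⟩ʳ x) ≡⟨ iter-suc π (pred (period π x)) x ⟨
    iter π (suc (pred (period π x))) x    ≡⟨ cong (λ m → iter π m x) (suc-pred (period π x)) ⟩
    iter π (period π x) x                 ≡⟨ iter-period π x ⟩
    x                                     ∎
    where open ≡-Reasoning

  period-≤ : ∀ {x y} → (∀ k .{{_ : NonZero k}} → iter π k x ≡ x → iter π k y ≡ y) →
             period π y ≤ period π x
  period-≤ {x} returns = period-minimal π (period π x) (returns (period π x) (iter-period π x))

  period-iter : ∀ k x → period π (iter π k x) ≡ period π x
  period-iter k x = ≤-antisym
    (period-≤ λ m e → trans (iter-comm π m k x) (cong (iter π k) e))
    (period-≤ λ m e → iter-injective π k (trans (iter-comm π k m x) e))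

  inCycle-below-period : ∀ {c a} → InCycle π c a → ∃ λ s → s < period π c × iter π s c ≡ a
  inCycle-below-period {c} (k , e) = k % period π c , m%n<n k (period π c) ,
    trans (sym (iter-%-return π (iter-period π c) k)) e

  inCycle? : ∀ c a → Dec (InCycle π c a)
  inCycle? c a with anyUpTo? (λ k → iter π k c ≟ᶠ a) (period π c)
  ... | yes (k , _ , e) = yes (k , e)
  ... | no none         = no λ a∈c → none (inCycle-below-period a∈c)

  inCycle-sym : ∀ {c a} → InCycle π c a → InCycle π a c
  inCycle-sym {c} a∈c with inCycle-below-period a∈c
  ... | s , s<p , refl = period π c ∸ s , (begin
    iter π (period π c ∸ s) (iter π s c) ≡⟨ iter-+ π (period π c ∸ s) s c ⟨
    iter π (period π c ∸ s + s) c        ≡⟨ cong (λ m → iter π m c) (m∸n+n≡m (<⇒≤ s<p)) ⟩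
    iter π (period π c) c                ≡⟨ iter-period π c ⟩
    c                                    ∎)
    where open ≡-Reasoning

  inCycle-trans : ∀ {c a b} → InCycle π c a → InCycle π a b → InCycle π c b
  inCycle-trans {c} (i , refl) (j , refl) = j + i , iter-+ π j i c

module _ (α β : Permutation′ n) where

  bad? : ∀ a → Dec (Bad α β a)
  bad? a = ¬? (α ⟨$⟩ʳ (β ⟨$⟩ʳ a) ≟ᶠ β ⟨$⟩ʳ (α ⟨$⟩ʳ a))

  commutes-at : ∀ {a} → ¬ Bad α β a → α ⟨$⟩ʳ (β ⟨$⟩ʳ a) ≡ β ⟨$⟩ʳ (α ⟨$⟩ʳ a)
  commutes-at {a} = decidable-stable (α ⟨$⟩ʳ (β ⟨$⟩ʳ a) ≟ᶠ β ⟨$⟩ʳ (α ⟨$⟩ʳ a))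

  commutes-along : ∀ {z} k → (∀ {i} → i < k → ¬ Bad α β (iter β i z)) →
                   α ⟨$⟩ʳ iter β k z ≡ iter β k (α ⟨$⟩ʳ z)
  commutes-along zero    good = refl
  commutes-along (suc k) good =
    trans (commutes-at (good (n<1+n k))) (cong (β ⟨$⟩ʳ_) (commutes-along k (good ∘ m<n⇒m<1+n)))

  AtMostOneBadPerCycle : Set
  AtMostOneBadPerCycle =
    ∀ {c a b} → InCycle β c a → InCycle β c b → Bad α β a → Bad α β b → a ≡ b

  TwoBadInSomeCycle : Set
  TwoBadInSomeCycle = ∃[ c ] CycleHasTwoBad α β c

  twoBadInSomeCycle? : Dec TwoBadInSomeCycle
  twoBadInSomeCycle? = any? λ c → any? λ a → any? λ b →
    ¬? (a ≟ᶠ b) ×-dec inCycle? β c a ×-dec inCycle? β c b ×-dec bad? a ×-dec bad? b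

  atMostOneBadPerCycle : ¬ TwoBadInSomeCycle → AtMostOneBadPerCycle
  atMostOneBadPerCycle ¬two {c} {a} {b} a∈c b∈c bad-a bad-b with a ≟ᶠ b
  ... | yes a≡b = a≡b
  ... | no  a≢b = ⊥-elim (¬two (c , a , b , a≢b , a∈c , b∈c , bad-a , bad-b))

  module _ (one-bad : AtMostOneBadPerCycle) where

    module _ {a} (bad-a : Bad α β a) where
      private
        p = period β a
        y = β ⟨$⟩ʳ a
        u = α ⟨$⟩ʳ y

        period-y : period β y ≡ p
        period-y = period-iter β 1 a

      good-after-bad : ∀ {i} → suc i < p → ¬ Bad α β (iter β i y)
      good-after-bad {i} i+1<p bad = <⇒≱ i+1<p (period-minimal β (suc i) returns)
        where
        returns : iter β (suc i) a ≡ a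
        returns = one-bad (suc i , refl) (0 , refl)
                          (subst (Bad α β) (sym (iter-suc β i a)) bad) bad-a

      commutes-after-bad : ∀ {s} → s < p → α ⟨$⟩ʳ iter β s y ≡ iter β s u
      commutes-after-bad s<p =
        commutes-along _ λ i<s → good-after-bad (≤-trans (s≤s i<s) s<p)

      period-after-bad : p < period β u
      period-after-bad = ≤∧≢⇒< p≤q p≢q
        where
        q = period β u
        y-returns : q < p → iter β q y ≡ y
        y-returns q<p = ⟨$⟩ʳ-injective α (trans (commutes-after-bad q<p) (iter-period β u))
        p≤q : p ≤ q
        p≤q = ≮⇒≥ λ q<p → <⇒≱ q<p (subst (_≤ q) period-y (period-minimal β q (y-returns q<p)))
        p≢q : p ≢ q
        p≢q p≡q = bad-a (begin
          α ⟨$⟩ʳ y                          ≡⟨ iter-period β u ⟨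
          iter β q u                        ≡⟨ cong (λ m → iter β m u) (trans (sym p≡q) (sym (suc-pred p))) ⟩
          β ⟨$⟩ʳ iter β (pred p) u          ≡⟨ cong (β ⟨$⟩ʳ_) (commutes-after-bad (≤-reflexive (suc-pred p))) ⟨
          β ⟨$⟩ʳ (α ⟨$⟩ʳ iter β (pred p) y) ≡⟨ cong (λ z → β ⟨$⟩ʳ (α ⟨$⟩ʳ z)) (iter-pred-period β a) ⟩
          β ⟨$⟩ʳ (α ⟨$⟩ʳ a)                 ∎)
          where open ≡-Reasoning

      period-grows-after-bad : ∀ {s} → s < p →
                               period β (iter β s y) < period β (α ⟨$⟩ʳ iter β s y)
      period-grows-after-bad {s} s<p = begin-strict
        period β (iter β s y)        ≡⟨ period-iter β s y ⟩
        period β y                   ≡⟨ period-y ⟩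
        p                            <⟨ period-after-bad ⟩
        period β u                   ≡⟨ period-iter β s u ⟨
        period β (iter β s u)        ≡⟨ cong (period β) (commutes-after-bad s<p) ⟨
        period β (α ⟨$⟩ʳ iter β s y) ∎
        where open ≤-Reasoning

      period-grows-on-bad-cycle : ∀ {z} → InCycle β z a → period β z < period β (α ⟨$⟩ʳ z)
      period-grows-on-bad-cycle {z} a∈z = grows (inCycle-below-period β z∈y)
        where
        z∈y : InCycle β y z
        z∈y = inCycle-trans β (inCycle-sym β (1 , refl)) (inCycle-sym β a∈z)
        grows : ∃ (λ s → s < period β y × iter β s y ≡ z) → period β z < period β (α ⟨$⟩ʳ z)
        grows (s , s<period-y , e) = subst (λ z → period β z < period β (α ⟨$⟩ʳ z)) e
          (period-grows-after-bad (subst (s <_) period-y s<period-y))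

    period-α-mono : ∀ z → period β z ≤ period β (α ⟨$⟩ʳ z)
    period-α-mono z with any? (λ b → inCycle? β z b ×-dec bad? b)
    ... | yes (b , b∈z , bad-b) = <⇒≤ (period-grows-on-bad-cycle bad-b b∈z)
    ... | no  none              = period-minimal β q (⟨$⟩ʳ-injective α (begin
      α ⟨$⟩ʳ iter β q z    ≡⟨ commutes-along q (λ {i} _ bad → none (_ , (i , refl) , bad)) ⟩
      iter β q (α ⟨$⟩ʳ z)  ≡⟨ iter-period β (α ⟨$⟩ʳ z) ⟩
      α ⟨$⟩ʳ z             ∎))
      where
      open ≡-Reasoning
      q = period β (α ⟨$⟩ʳ z)

    period-α-iter-mono : ∀ m z → period β z ≤ period β (iter α m z)
    period-α-iter-mono zero    z = ≤-refl
    period-α-iter-mono (suc m) z = ≤-trans (period-α-iter-mono m z) (period-α-mono (iter α m z))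

    no-bad-point : ∀ {a} → ¬ Bad α β a
    no-bad-point {a} bad-a = <-irrefl refl (begin-strict
      period β a                     <⟨ period-grows-on-bad-cycle bad-a (0 , refl) ⟩
      period β (α ⟨$⟩ʳ a)            ≤⟨ period-α-iter-mono m (α ⟨$⟩ʳ a) ⟩
      period β (iter α m (α ⟨$⟩ʳ a)) ≡⟨ cong (period β) (iter-pred-period α a) ⟩
      period β a                     ∎)
      where
      open ≤-Reasoning
      m = pred (period α a)

proposition16 : ∀ (n : ℕ) (α β : Permutation′ n) →
    ∃[ c ] CycleHasExactlyOneBad α β c →
    ∃[ c ] CycleHasTwoBad α β c
proposition16 n α β (_ , a , _ , bad-a , _) with twoBadInSomeCycle? α β
... | yes two  = two
... | no  ¬two = ⊥-elim (no-bad-point α β (atMostOneBadPerCycle α β ¬two) bad-a)
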